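{- Let $k$ be a nonnegative integer and $S\in\mathsf{APS}^B_{2k+1}\setminus\mathsf{APS}^D_{2k+1}$, and set $N=S\cap-\mathbb{N}$. Then $|N|$ and $|S|$ have the same parity.
   Context: $\mathbb{N}=\{1,2,\dots\}$, $[n]=\{1,\dots,n\}$, $\pm[n]=[n]\cup-[n]$. $\mathfrak{S}_n^B$ is the group of bijections $w:\pm[n]\to\pm[n]$ with $w(-i)=-w(i)$, written in one-line notation $w(1)\cdots w(n)$; $\mathfrak{S}_n^D\subseteq\mathfrak{S}_n^B$ consists of those $w$ with $|\{i\in[n]:w(i)<0\}|$ even. A pinnacle of $w$ is a value $w(i)$ with $2\le i\le n-1$ and $w(i-1)<w(i)>w(i+1)$; the pinnacle set of $w$ is the set of its pinnacles. $\mathsf{APS}^B_n$ (resp. $\mathsf{APS}^D_n$) is the set of pinnacle sets of elements of $\mathfrak{S}_n^B$ (resp. $\mathfrak{S}_n^D$). -}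

module Defs where

open import Data.Nat using (ℕ; suc; _%_)
open import Data.Integer using (ℤ; ∣_∣; _<?_; 0ℤ)
open import Data.List using (List; []; _∷_; map; upTo; filter; length)
open import Data.List.Membership.Propositional using (_∈_)
open import Data.List.Relation.Binary.Permutation.Propositional using (_↭_)
open import Data.Bool using (if_then_else_; _∧_)
open import Data.Product using (Σ; _×_)
open import Function.Bundles using (_⇔_)
open import Relation.Nullary.Decidable using (⌊_⌋)
open import Relation.Binary.PropositionalEquality using (_≡_)

-- A signed permutation of [n] in one-line notation w(1) ... w(n):
-- a list of integers whose absolute values are a rearrangement of 1,...,n.
-- (The values w(-i) = -w(i) are then determined.)
IsSignedPerm : ℕ → List ℤ → Set
IsSignedPerm n w = map ∣_∣ w ↭ map suc (upTo n)

negCount : List ℤ → ℕ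
negCount w = length (filter (_<? 0ℤ) w)

IsTypeDPerm : ℕ → List ℤ → Set
IsTypeDPerm n w = IsSignedPerm n w × (negCount w % 2 ≡ 0)

pinnacles : List ℤ → List ℤ
pinnacles (a ∷ b ∷ c ∷ xs) =
  if ⌊ a <? b ⌋ ∧ ⌊ c <? b ⌋
  then b ∷ pinnacles (b ∷ c ∷ xs)
  else pinnacles (b ∷ c ∷ xs)
pinnacles _ = []

IsPinnacleSetOf : List ℤ → List ℤ → Set
IsPinnacleSetOf S w = (x : ℤ) → (x ∈ S) ⇔ (x ∈ pinnacles w)

APSB : ℕ → List ℤ → Set
APSB n S = Σ (List ℤ) λ w → IsSignedPerm n w × IsPinnacleSetOf S w

APSD : ℕ → List ℤ → Set
APSD n S = Σ (List ℤ) λ w → IsTypeDPerm n w × IsPinnacleSetOf S w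

-- Let w be a signed permutation with pinnacle set S and an odd number of negative entries.
-- If some non-pinnacle entry of w were positive, the sign of some non-pinnacle entry could
-- be changed without changing the pinnacle set, and the result would be a type D permutation
-- with pinnacle set S. To find that entry, start at a positive non-pinnacle x and look at its
-- neighbours y. Changing x to -x only affects comparisons with neighbours with |y| < |x|; a
-- positive such y is a smaller positive non-pinnacle, so we descend to it, and a negative
-- such y can only become a pinnacle if its other neighbour z lies below it, in which case y
-- is a local minimum of |w| and it is y whose sign can be changed. Hence all non-pinnacles
-- are negative, so the negative entries of w are the n - |S| non-pinnacles together with the
-- negative pinnacles; as n and the number of negative entries are odd, |N| ≡ |S| (mod 2).
module Submission where

open import Defs
open import Data.Nat using (ℕ; suc; _+_; _*_; _%_)
open import Data.Integer using (ℤ; _<?_; 0ℤ)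
open import Data.List using (List; filter; length)
open import Data.List.Relation.Unary.Unique.Propositional using (Unique)
open import Relation.Nullary using (¬_)
open import Relation.Binary.PropositionalEquality using (_≡_)

open import Data.Nat using (zero; s<s; z<s; s<s⁻¹)
import Data.Nat as ℕ
import Data.Nat.Properties as ℕ
open import Data.Nat.DivMod using (%-distribˡ-+; [m+kn]%n≡m%n)
open import Data.Nat.Induction using (<-wellFounded)
open import Induction.WellFounded using (Acc; acc)
open import Data.Integer using (+_; +0; +[1+_]; -[1+_]; -_; ∣_∣; _<_; +<+; -<+; -<-)
import Data.Integer.Properties as ℤ
open import Data.List using ([]; _∷_; map; upTo)
import Data.List.Properties as List
open import Data.List.Membership.Propositional using (_∈_; _∉_)
open import Data.List.Membership.Propositional.Properties using (∈-map⁺; ∈-map⁻)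
open import Data.List.Membership.Propositional.Properties.WithK using (unique∧set⇒bag)
open import Data.List.Relation.Unary.Any using (here; there)
open import Data.List.Relation.Unary.All using (_∷_)
open import Data.List.Relation.Unary.All.Properties.Core using (¬Any⇒All¬)
open import Data.List.Relation.Unary.AllPairs using ([]; _∷_)
import Data.List.Relation.Unary.Unique.Propositional.Properties as Unique
open import Data.List.Relation.Binary.BagAndSetEquality using (∼bag⇒↭)
open import Data.List.Relation.Binary.Permutation.Propositional using (_↭_; ↭-sym; ↭⇒↭ₛ)
open import Data.List.Relation.Binary.Permutation.Propositional.Properties
  using (∈-resp-↭; filter-↭; ↭-length)
open import Data.List.Relation.Binary.Permutation.Setoid.Properties using (Unique-resp-↭)
open import Data.Bool using (if_then_else_)
open import Data.Product using (Σ; _×_; _,_; proj₁; proj₂)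
open import Data.Sum using (_⊎_; inj₁; inj₂; [_,_]′)
open import Data.Empty using (⊥; ⊥-elim)
open import Function using (_∘_; id)
open import Function.Construct.Composition using (_⇔-∘_)
open import Function.Construct.Symmetry using (⇔-sym)
open import Function.Bundles using (_⇔_; mk⇔; Equivalence)
open import Relation.Nullary using (Dec; yes; no; does)
open import Relation.Nullary.Decidable using (_×-dec_; _⊎-dec_)
open import Relation.Binary.Definitions using (tri<; tri≈; tri>)
open import Relation.Binary.PropositionalEquality
  using (_≢_; refl; sym; trans; cong; cong₂; subst; subst₂; setoid)
open Relation.Binary.PropositionalEquality.≡-Reasoning

%2-dichotomy : ∀ m → m % 2 ≡ 0 ⊎ m % 2 ≡ 1
%2-dichotomy zero = inj₁ refl
%2-dichotomy (suc zero) = inj₂ refl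
%2-dichotomy (suc (suc m)) = %2-dichotomy m

%2-suc-cong : ∀ m n → m % 2 ≡ n % 2 → suc m % 2 ≡ suc n % 2
%2-suc-cong m n e =
  trans (%-distribˡ-+ 1 m 2) (trans (cong (λ r → (1 + r) % 2) e) (sym (%-distribˡ-+ 1 n 2)))

%2-suc-cancel : ∀ {m n} → suc m % 2 ≡ suc n % 2 → m % 2 ≡ n % 2
%2-suc-cancel {zero} {zero} _ = refl
%2-suc-cancel {zero} {suc zero} ()
%2-suc-cancel {suc zero} {zero} ()
%2-suc-cancel {suc zero} {suc zero} _ = refl
%2-suc-cancel {suc (suc m)} {n} e = %2-suc-cancel {m} {n} e
%2-suc-cancel {m} {suc (suc n)} e = %2-suc-cancel {m} {n} e

odd-+ : ∀ m n → m % 2 ≡ 1 → (m + n) % 2 ≡ suc n % 2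
odd-+ (suc zero) n _ = refl
odd-+ (suc (suc m)) n h = odd-+ m n h

odd-+-cancel : ∀ {a b c d} → a % 2 ≡ 1 → c % 2 ≡ 1 → a + b ≡ c + d → b % 2 ≡ d % 2
odd-+-cancel {a} {b} {c} {d} ha hc e =
  %2-suc-cancel {b} {d} (trans (sym (odd-+ a b ha)) (trans (cong (_% 2) e) (odd-+ c d hc)))

2k+1%2≡1 : ∀ k → (2 * k + 1) % 2 ≡ 1
2k+1%2≡1 k = trans (cong (_% 2) (trans (ℕ.+-comm (2 * k) 1) (cong (λ m → 1 + m) (ℕ.*-comm 2 k))))
                   ([m+kn]%n≡m%n 1 k 2)

neg<pos : ∀ {x} → 0ℤ < x → - x < x
neg<pos p = ℤ.<-trans (ℤ.neg-mono-< p) p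

∣∣<⇒same-side : ∀ {x y} → ∣ x ∣ ℕ.< ∣ y ∣ → (x < y × - x < y) ⊎ (y < x × y < - x)
∣∣<⇒same-side {+0} {+[1+ _ ]} _ = inj₁ (+<+ z<s , +<+ z<s)
∣∣<⇒same-side {+[1+ _ ]} {+[1+ _ ]} lt = inj₁ (+<+ lt , -<+)
∣∣<⇒same-side { -[1+ _ ]} {+[1+ _ ]} lt = inj₁ (-<+ , +<+ lt)
∣∣<⇒same-side {+0} { -[1+ _ ]} _ = inj₂ (-<+ , -<+)
∣∣<⇒same-side {+[1+ _ ]} { -[1+ _ ]} lt = inj₂ (-<+ , -<- (s<s⁻¹ lt))
∣∣<⇒same-side { -[1+ _ ]} { -[1+ _ ]} lt = inj₂ (-<- (s<s⁻¹ lt) , -<+)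

∣∣<⇒<-neg : ∀ {x y} → ∣ x ∣ ℕ.< ∣ y ∣ → x < y ⇔ - x < y
∣∣<⇒<-neg lt with ∣∣<⇒same-side lt
... | inj₁ (p , q) = mk⇔ (λ _ → q) (λ _ → p)
... | inj₂ (p , q) = mk⇔ (λ r → ⊥-elim (ℤ.<-asym p r)) (λ r → ⊥-elim (ℤ.<-asym q r))

∣∣<⇒>-neg : ∀ {x y} → ∣ x ∣ ℕ.< ∣ y ∣ → y < x ⇔ y < - x
∣∣<⇒>-neg lt with ∣∣<⇒same-side lt
... | inj₁ (p , q) = mk⇔ (λ r → ⊥-elim (ℤ.<-asym p r)) (λ r → ⊥-elim (ℤ.<-asym q r))
... | inj₂ (p , q) = mk⇔ (λ _ → q) (λ _ → p)

<-resp-≡ : ∀ {a b c d} → a ≡ c → b ≡ d → a < b ⇔ c < d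
<-resp-≡ refl refl = mk⇔ id id

<-neg⇒∣∣> : ∀ {x y} → x < y → y < 0ℤ → ∣ y ∣ ℕ.< ∣ x ∣
<-neg⇒∣∣> (-<- lt) -<+ = s<s lt

∣∣<-pos⇒< : ∀ {x y} → 0ℤ < x → 0ℤ < y → ∣ x ∣ ℕ.< ∣ y ∣ → x < y
∣∣<-pos⇒< {+ _} {+ _} _ _ lt = +<+ lt

-- Positions are 0-based; reading past the end gives the junk value 0ℤ.
get : List ℤ → ℕ → ℤ
get [] _ = 0ℤ
get (x ∷ xs) zero = x
get (x ∷ xs) (suc i) = get xs i

flipAt : ℕ → List ℤ → List ℤ
flipAt _ [] = []
flipAt zero (x ∷ xs) = - x ∷ xs
flipAt (suc j) (x ∷ xs) = x ∷ flipAt j xs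

get-flipAt-≡ : ∀ j w → get (flipAt j w) j ≡ - get w j
get-flipAt-≡ j [] = refl
get-flipAt-≡ zero (x ∷ w) = refl
get-flipAt-≡ (suc j) (x ∷ w) = get-flipAt-≡ j w

get-flipAt-≢ : ∀ j w {i} → j ≢ i → get (flipAt j w) i ≡ get w i
get-flipAt-≢ j [] _ = refl
get-flipAt-≢ zero (x ∷ w) {zero} ne = ⊥-elim (ne refl)
get-flipAt-≢ zero (x ∷ w) {suc i} _ = refl
get-flipAt-≢ (suc j) (x ∷ w) {zero} _ = refl
get-flipAt-≢ (suc j) (x ∷ w) {suc i} ne = get-flipAt-≢ j w (ne ∘ cong suc)

length-flipAt : ∀ j w → length (flipAt j w) ≡ length w
length-flipAt j [] = refl
length-flipAt zero (x ∷ w) = refl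
length-flipAt (suc j) (x ∷ w) = cong suc (length-flipAt j w)

map-∣∣-flipAt : ∀ j w → map ∣_∣ (flipAt j w) ≡ map ∣_∣ w
map-∣∣-flipAt j [] = refl
map-∣∣-flipAt zero (x ∷ w) = cong (_∷ map ∣_∣ w) (ℤ.∣-i∣≡∣i∣ x)
map-∣∣-flipAt (suc j) (x ∷ w) = cong (∣ x ∣ ∷_) (map-∣∣-flipAt j w)

negCount-flipAt : ∀ j w → j ℕ.< length w → get w j ≢ 0ℤ →
                  negCount (flipAt j w) % 2 ≡ suc (negCount w) % 2
negCount-flipAt zero (+0 ∷ w) _ ne = ⊥-elim (ne refl)
negCount-flipAt zero (+[1+ _ ] ∷ w) _ _ = refl
negCount-flipAt zero (-[1+ _ ] ∷ w) _ _ = refl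
negCount-flipAt (suc j) (x ∷ w) lt ne with x <? 0ℤ
... | yes _ = %2-suc-cong (negCount (flipAt j w)) (suc (negCount w)) (negCount-flipAt j w (s<s⁻¹ lt) ne)
... | no _ = negCount-flipAt j w (s<s⁻¹ lt) ne

-- Pinnacles by position

Adjacent : ℕ → ℕ → Set
Adjacent i k = suc i ≡ k ⊎ suc k ≡ i

adjacent-sym : ∀ {i k} → Adjacent i k → Adjacent k i
adjacent-sym (inj₁ e) = inj₂ e
adjacent-sym (inj₂ e) = inj₁ e

adjacent⇒≢ : ∀ {i k} → Adjacent i k → i ≢ k
adjacent⇒≢ (inj₁ e) refl = ℕ.1+n≢n e
adjacent⇒≢ (inj₂ e) refl = ℕ.1+n≢n e

adjacent? : ∀ i k → Dec (Adjacent i k)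
adjacent? i k = (suc i ℕ.≟ k) ⊎-dec (suc k ℕ.≟ i)

Pinnacle : (ℕ → ℤ) → ℕ → ℕ → Set
Pinnacle g n zero = ⊥
Pinnacle g n (suc i) = suc (suc i) ℕ.< n × g i < g (suc i) × g (suc (suc i)) < g (suc i)

pinnacle⇒< : ∀ {g n} i → Pinnacle g n i → i ℕ.< n
pinnacle⇒< (suc i) (bound , _) = ℕ.<-trans (ℕ.n<1+n (suc i)) bound

pinnacle⇒above : ∀ {g n i m} → Pinnacle g n i → Adjacent i m → g m < g i
pinnacle⇒above {i = suc i} (_ , _ , right) (inj₁ refl) = right
pinnacle⇒above {i = suc i} (_ , left , _) (inj₂ refl) = left

pinnacle-mono : ∀ {g h n} i → (∀ m → Adjacent i m → m ℕ.< n → g m < g i → h m < h i) →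
                Pinnacle g n i → Pinnacle h n i
pinnacle-mono (suc i) f (bound , left , right) =
  bound ,
  f i (inj₂ refl) (ℕ.<-trans (ℕ.n<1+n i) (ℕ.<-trans (ℕ.n<1+n (suc i)) bound)) left ,
  f (suc (suc i)) (inj₁ refl) bound right

pinnacle-cong : ∀ {g h n} i → (∀ m → Adjacent i m → m ℕ.< n → g m < g i ⇔ h m < h i) →
                Pinnacle g n i ⇔ Pinnacle h n i
pinnacle-cong i f = mk⇔ (pinnacle-mono i (λ m a b → Equivalence.to (f m a b)))
                        (pinnacle-mono i (λ m a b → Equivalence.from (f m a b)))

record SafeFlip (w : List ℤ) (j : ℕ) : Set where
  field
    bounded : j ℕ.< length w
    not-pinnacle : ¬ Pinnacle (get w) (length w) j
    same-pinnacles : ∀ i → Pinnacle (get w) (length w) i ⇔ Pinnacle (get (flipAt j w)) (length w) i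

NonPinnaclesNegative : List ℤ → Set
NonPinnaclesNegative w = ∀ i → i ℕ.< length w → ¬ Pinnacle (get w) (length w) i → get w i < 0ℤ

right-neighbour-⊎ : ∀ {P : ℕ → Set} {B : Set} n j →
                    (∀ k → suc j ≡ k → k ℕ.< n → P k ⊎ B) →
                    (∀ k → suc j ≡ k → k ℕ.< n → P k) ⊎ B
right-neighbour-⊎ n j f with suc j ℕ.<? n
... | no ¬bound = inj₁ λ { _ refl bound → ⊥-elim (¬bound bound) }
... | yes bound with f (suc j) refl bound
...   | inj₁ p = inj₁ λ { _ refl _ → p }
...   | inj₂ b = inj₂ b

left-neighbour-⊎ : ∀ {P : ℕ → Set} {B : Set} n j → j ℕ.< n →
                   (∀ k → suc k ≡ j → k ℕ.< n → P k ⊎ B) →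
                   (∀ k → suc k ≡ j → k ℕ.< n → P k) ⊎ B
left-neighbour-⊎ n zero _ f = inj₁ λ _ ()
left-neighbour-⊎ n (suc i) bound f with f i refl (ℕ.<-trans (ℕ.n<1+n i) bound)
... | inj₁ p = inj₁ λ { _ refl _ → p }
... | inj₂ b = inj₂ b

neighbours-⊎ : ∀ {P : ℕ → Set} {B : Set} n j → j ℕ.< n →
               (∀ k → Adjacent j k → k ℕ.< n → P k ⊎ B) →
               (∀ k → Adjacent j k → k ℕ.< n → P k) ⊎ B
neighbours-⊎ n j bound f
  with right-neighbour-⊎ n j (λ k e → f k (inj₁ e)) | left-neighbour-⊎ n j bound (λ k e → f k (inj₂ e))
... | inj₂ b | _ = inj₂ b
... | inj₁ _ | inj₂ b = inj₂ b
... | inj₁ right | inj₁ left = inj₁ λ { k (inj₁ e) → right k e ; k (inj₂ e) → left k e }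

-- Finding a safe flip

module SafeFlipSearch (w : List ℤ)
  (nonzero : ∀ i → i ℕ.< length w → get w i ≢ 0ℤ)
  (abs-distinct : ∀ i → suc i ℕ.< length w → ∣ get w i ∣ ≢ ∣ get w (suc i) ∣) where

  private
    n : ℕ
    n = length w

    g : ℕ → ℤ
    g = get w

    flipped : ℕ → ℕ → ℤ
    flipped j = get (flipAt j w)

  adjacent-abs-distinct : ∀ {i k} → Adjacent i k → i ℕ.< n → k ℕ.< n → ∣ g i ∣ ≢ ∣ g k ∣
  adjacent-abs-distinct (inj₁ refl) _ k<n = abs-distinct _ k<n
  adjacent-abs-distinct (inj₂ refl) i<n _ = abs-distinct _ i<n ∘ sym

  flip-stable-away : ∀ j i → i ≢ j → ¬ Adjacent i j → Pinnacle g n i ⇔ Pinnacle (flipped j) n i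
  flip-stable-away j i i≢j ¬adj = pinnacle-cong i λ m adj _ →
    <-resp-≡ (sym (get-flipAt-≢ j w λ { refl → ¬adj adj })) (sym (get-flipAt-≢ j w (i≢j ∘ sym)))

  flip-stable-neighbour : ∀ {j k} → Adjacent j k → ∣ g j ∣ ℕ.< ∣ g k ∣ →
                          Pinnacle g n k ⇔ Pinnacle (flipped j) n k
  flip-stable-neighbour {j} {k} adj smaller = pinnacle-cong k λ m adj′ _ → compare m adj′
    where
    unflipped-k : flipped j k ≡ g k
    unflipped-k = get-flipAt-≢ j w (adjacent⇒≢ adj)

    compare : ∀ m → Adjacent k m → g m < g k ⇔ flipped j m < flipped j k
    compare m adj′ with j ℕ.≟ m
    ... | yes refl = <-resp-≡ (sym (get-flipAt-≡ j w)) (sym unflipped-k) ⇔-∘ ∣∣<⇒<-neg smaller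
    ... | no j≢m = <-resp-≡ (sym (get-flipAt-≢ j w j≢m)) (sym unflipped-k)

  flip-stable-centre : ∀ j → (∀ k → Adjacent j k → k ℕ.< n → ∣ g j ∣ ℕ.< ∣ g k ∣) →
                       Pinnacle g n j ⇔ Pinnacle (flipped j) n j
  flip-stable-centre j smaller = pinnacle-cong j λ m adj m<n →
    <-resp-≡ (sym (get-flipAt-≢ j w (adjacent⇒≢ adj))) (sym (get-flipAt-≡ j w))
      ⇔-∘ ∣∣<⇒>-neg (smaller m adj m<n)

  flipped-positive-pinnacle : ∀ j → 0ℤ < g j → Pinnacle (flipped j) n j → Pinnacle g n j
  flipped-positive-pinnacle j pos = pinnacle-mono j λ m adj _ m<j →
    ℤ.<-trans (subst₂ _<_ (get-flipAt-≢ j w (adjacent⇒≢ adj)) (get-flipAt-≡ j w) m<j) (neg<pos pos)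

  local⇒safeFlip : ∀ j → j ℕ.< n → ¬ Pinnacle g n j → ¬ Pinnacle (flipped j) n j →
             (∀ k → Adjacent j k → k ℕ.< n → Pinnacle g n k ⇔ Pinnacle (flipped j) n k) →
             SafeFlip w j
  local⇒safeFlip j bound ¬pin ¬pin′ stable = record
    { bounded = bound ; not-pinnacle = ¬pin ; same-pinnacles = same }
    where
    same : ∀ i → Pinnacle g n i ⇔ Pinnacle (flipped j) n i
    same i with i ℕ.≟ j | adjacent? j i
    ... | yes refl | _ = mk⇔ (⊥-elim ∘ ¬pin) (⊥-elim ∘ ¬pin′)
    ... | no _ | yes adj = mk⇔ (λ p → Equivalence.to (stable i adj (pinnacle⇒< i p)) p)
                                (λ p → Equivalence.from (stable i adj (pinnacle⇒< i p)) p)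
    ... | no i≢j | no ¬adj = flip-stable-away j i i≢j (¬adj ∘ adjacent-sym)

  -- No comparison with a neighbour changes.
  safeFlip-at-abs-minimum : ∀ j → j ℕ.< n → ¬ Pinnacle g n j →
                            (∀ k → Adjacent j k → k ℕ.< n → ∣ g j ∣ ℕ.< ∣ g k ∣) → SafeFlip w j
  safeFlip-at-abs-minimum j bound ¬pin smaller =
    local⇒safeFlip j bound ¬pin (¬pin ∘ Equivalence.from (flip-stable-centre j smaller))
             (λ k adj k<n → flip-stable-neighbour adj (smaller k adj k<n))

  -- Flipping the positive j can only make its smaller negative neighbour k a pinnacle if the
  -- other neighbour of k lies below k; then k itself is a local minimum of |w|.
  negative-neighbour : ∀ {j k} → Adjacent j k → k ℕ.< n →
                       0ℤ < g j → g k < 0ℤ → ∣ g k ∣ ℕ.< ∣ g j ∣ →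
                       (Pinnacle g n k ⇔ Pinnacle (flipped j) n k) ⊎ Σ ℕ (SafeFlip w)
  negative-neighbour {j} {k} adj k<n pos neg smaller =
    [ (λ minimum → inj₂ (k , safeFlip-at-abs-minimum k k<n ¬pin minimum)) , inj₁ ]′
      (neighbours-⊎ n k k<n other)
    where
    ¬pin : ¬ Pinnacle g n k
    ¬pin p = ℤ.<-asym (ℤ.<-trans neg pos) (pinnacle⇒above p (adjacent-sym adj))

    other : ∀ m → Adjacent k m → m ℕ.< n →
            ∣ g k ∣ ℕ.< ∣ g m ∣ ⊎ (Pinnacle g n k ⇔ Pinnacle (flipped j) n k)
    other m adj′ _ with j ℕ.≟ m
    ... | yes refl = inj₁ smaller
    ... | no j≢m with g m <? g k
    ...   | yes m<k = inj₁ (<-neg⇒∣∣> m<k neg)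
    ...   | no m≮k = inj₂ (mk⇔ (⊥-elim ∘ ¬pin) λ p → ⊥-elim (m≮k
              (subst₂ _<_ (get-flipAt-≢ j w j≢m) (get-flipAt-≢ j w (adjacent⇒≢ adj))
                      (pinnacle⇒above p adj′))))

  safeFlip-from-positive : ∀ j → Acc ℕ._<_ ∣ g j ∣ → j ℕ.< n → 0ℤ < g j → ¬ Pinnacle g n j →
                           Σ ℕ (SafeFlip w)
  safeFlip-from-positive j (acc descend) j<n pos ¬pin =
    [ (λ stable → j , local⇒safeFlip j j<n ¬pin (¬pin ∘ flipped-positive-pinnacle j pos) stable)
    , id ]′
      (neighbours-⊎ n j j<n neighbour)
    where
    neighbour : ∀ k → Adjacent j k → k ℕ.< n →
                (Pinnacle g n k ⇔ Pinnacle (flipped j) n k) ⊎ Σ ℕ (SafeFlip w)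
    neighbour k adj k<n with ℕ.<-cmp ∣ g j ∣ ∣ g k ∣
    ... | tri< larger _ _ = inj₁ (flip-stable-neighbour adj larger)
    ... | tri≈ _ same _ = ⊥-elim (adjacent-abs-distinct adj j<n k<n same)
    ... | tri> _ _ smaller with ℤ.<-cmp (g k) 0ℤ
    ...   | tri< neg _ _ = negative-neighbour adj k<n pos neg smaller
    ...   | tri≈ _ eq₀ _ = ⊥-elim (nonzero k k<n eq₀)
    ...   | tri> _ _ pos′ = inj₂ (safeFlip-from-positive k (descend smaller) k<n pos′
              λ p → ℤ.<-asym (pinnacle⇒above p (adjacent-sym adj)) (∣∣<-pos⇒< pos′ pos smaller))

  nonPinnaclesNegative : (∀ j → ¬ SafeFlip w j) → NonPinnaclesNegative w
  nonPinnaclesNegative noSafeFlip i i<n ¬pin with ℤ.<-cmp (g i) 0ℤ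
  ... | tri< neg _ _ = neg
  ... | tri≈ _ eq₀ _ = ⊥-elim (nonzero i i<n eq₀)
  ... | tri> _ _ pos with safeFlip-from-positive i (<-wellFounded _) i<n pos ¬pin
  ...   | j , safe = ⊥-elim (noSafeFlip j safe)

-- The list of pinnacles

pinnacle-∷ : ∀ a t {L} i → Pinnacle (get (a ∷ t)) (suc L) (suc (suc i)) ⇔ Pinnacle (get t) L (suc i)
pinnacle-∷ a t i =
  mk⇔ (λ { (bound , above) → s<s⁻¹ bound , above }) (λ { (bound , above) → s<s bound , above })

pinnacles-∷∷∷ : ∀ a b c t → pinnacles (a ∷ b ∷ c ∷ t) ≡
                (if does ((a <? b) ×-dec (c <? b))
                   then b ∷ pinnacles (b ∷ c ∷ t) else pinnacles (b ∷ c ∷ t))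
pinnacles-∷∷∷ a b c t with a <? b | c <? b
... | yes _ | yes _ = refl
... | yes _ | no _ = refl
... | no _ | _ = refl

if-∷-cong : ∀ {A B : Set} {b b′ : ℤ} {P P′ : List ℤ} (a? : Dec A) (b? : Dec B) →
            A ⇔ B → (A → b ≡ b′) → P ≡ P′ →
            (if does a? then b ∷ P else P) ≡ (if does b? then b′ ∷ P′ else P′)
if-∷-cong (yes a) (yes _) _ head tail = cong₂ _∷_ (head a) tail
if-∷-cong (no _) (no _) _ _ tail = tail
if-∷-cong (yes a) (no ¬b) A⇔B _ _ = ⊥-elim (¬b (Equivalence.to A⇔B a))
if-∷-cong (no ¬a) (yes b) A⇔B _ _ = ⊥-elim (¬a (Equivalence.from A⇔B b))

pinnacles-cong : ∀ v w → length v ≡ length w →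
                 (∀ i → Pinnacle (get v) (length v) i ⇔ Pinnacle (get w) (length v) i) →
                 (∀ i → Pinnacle (get v) (length v) i → get v i ≡ get w i) →
                 pinnacles v ≡ pinnacles w
pinnacles-cong [] [] _ _ _ = refl
pinnacles-cong (_ ∷ []) (_ ∷ []) _ _ _ = refl
pinnacles-cong (_ ∷ _ ∷ []) (_ ∷ _ ∷ []) _ _ _ = refl
pinnacles-cong (a ∷ b ∷ c ∷ v) (a′ ∷ b′ ∷ c′ ∷ w) eq same value = begin
  pinnacles (a ∷ b ∷ c ∷ v)
    ≡⟨ pinnacles-∷∷∷ a b c v ⟩
  (if does ((a <? b) ×-dec (c <? b)) then b ∷ pinnacles t else pinnacles t)
    ≡⟨ if-∷-cong ((a <? b) ×-dec (c <? b)) ((a′ <? b′) ×-dec (c′ <? b′))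
         (mk⇔ (proj₂ ∘ Equivalence.to (same 1) ∘ (three ,_))
              (proj₂ ∘ Equivalence.from (same 1) ∘ (three ,_)))
         (value 1 ∘ (three ,_))
         (pinnacles-cong (b ∷ c ∷ v) (b′ ∷ c′ ∷ w) (ℕ.suc-injective eq) same′ value′) ⟩
  (if does ((a′ <? b′) ×-dec (c′ <? b′)) then b′ ∷ pinnacles t′ else pinnacles t′)
    ≡⟨ pinnacles-∷∷∷ a′ b′ c′ w ⟨
  pinnacles (a′ ∷ b′ ∷ c′ ∷ w) ∎
  where
  t t′ : List ℤ
  t = b ∷ c ∷ v
  t′ = b′ ∷ c′ ∷ w

  three : 2 ℕ.< length (a ∷ t)
  three = s<s (s<s z<s)

  same′ : ∀ i → Pinnacle (get t) (length t) i ⇔ Pinnacle (get t′) (length t) i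
  same′ zero = mk⇔ id id
  same′ (suc i) = pinnacle-∷ a′ t′ i ⇔-∘ (same (suc (suc i)) ⇔-∘ ⇔-sym (pinnacle-∷ a t i))

  value′ : ∀ i → Pinnacle (get t) (length t) i → get t i ≡ get t′ i
  value′ (suc i) = value (suc (suc i)) ∘ Equivalence.from (pinnacle-∷ a t i)
pinnacles-cong [] (_ ∷ _) () _ _
pinnacles-cong (_ ∷ _) [] () _ _
pinnacles-cong (_ ∷ []) (_ ∷ _ ∷ _) () _ _
pinnacles-cong (_ ∷ _ ∷ _) (_ ∷ []) () _ _
pinnacles-cong (_ ∷ _ ∷ []) (_ ∷ _ ∷ _ ∷ _) () _ _
pinnacles-cong (_ ∷ _ ∷ _ ∷ _) (_ ∷ _ ∷ []) () _ _

pinnacles-flipAt : ∀ {w j} → SafeFlip w j → pinnacles w ≡ pinnacles (flipAt j w)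
pinnacles-flipAt {w} {j} safe =
  pinnacles-cong w (flipAt j w) (sym (length-flipAt j w)) same-pinnacles
    (λ i p → sym (get-flipAt-≢ j w λ { refl → not-pinnacle p }))
  where open SafeFlip safe

∈-if-∷ : ∀ {A : Set} {x b : ℤ} {P} (a? : Dec A) →
         x ∈ (if does a? then b ∷ P else P) → x ≡ b ⊎ x ∈ P
∈-if-∷ (yes _) (here e) = inj₁ e
∈-if-∷ (yes _) (there x∈) = inj₂ x∈
∈-if-∷ (no _) x∈ = inj₂ x∈

∈-pinnacles⇒∈ : ∀ a t {x} → x ∈ pinnacles (a ∷ t) → x ∈ t
∈-pinnacles⇒∈ a (b ∷ c ∷ t) x∈ =
  [ here , there ∘ ∈-pinnacles⇒∈ b (c ∷ t) ]′
    (∈-if-∷ ((a <? b) ×-dec (c <? b)) (subst (_ ∈_) (pinnacles-∷∷∷ a b c t) x∈))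

unique-if-∷ : ∀ {A : Set} {b : ℤ} {P} (a? : Dec A) → b ∉ P → Unique P →
              Unique (if does a? then b ∷ P else P)
unique-if-∷ (yes _) b∉P u = ¬Any⇒All¬ _ b∉P ∷ u
unique-if-∷ (no _) _ u = u

pinnacles-unique : ∀ w → Unique w → Unique (pinnacles w)
pinnacles-unique [] _ = []
pinnacles-unique (_ ∷ []) _ = []
pinnacles-unique (_ ∷ _ ∷ []) _ = []
pinnacles-unique (a ∷ b ∷ c ∷ t) (_ ∷ u) =
  subst Unique (sym (pinnacles-∷∷∷ a b c t))
    (unique-if-∷ ((a <? b) ×-dec (c <? b))
      (Unique.Unique[x∷xs]⇒x∉xs u ∘ ∈-pinnacles⇒∈ b (c ∷ t)) (pinnacles-unique (b ∷ c ∷ t) u))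

negCount-if-∷ : ∀ {A : Set} {x r P} (a? : Dec A) → (¬ A → x < 0ℤ) →
                negCount r + length P ≡ length r + negCount P →
                let P′ = if does a? then x ∷ P else P in
                negCount (x ∷ r) + length P′ ≡ length (x ∷ r) + negCount P′
negCount-if-∷ {x = x} {r} {P} (yes _) _ count with x <? 0ℤ
... | yes _ =
  cong suc (trans (ℕ.+-suc (negCount r) _) (trans (cong suc count) (sym (ℕ.+-suc (length r) _))))
... | no _ = trans (ℕ.+-suc (negCount r) _) (cong suc count)
negCount-if-∷ {x = x} (no ¬a) below count with x <? 0ℤ
... | yes _ = cong suc count
... | no x≮0 = ⊥-elim (x≮0 (below ¬a))

negCount-pinnacles-∷ : ∀ a t →
  (∀ i → i ℕ.< length t → ¬ Pinnacle (get (a ∷ t)) (suc (length t)) (suc i) → get t i < 0ℤ) →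
  negCount t + length (pinnacles (a ∷ t)) ≡ length t + negCount (pinnacles (a ∷ t))
negCount-pinnacles-∷ a [] _ = refl
negCount-pinnacles-∷ a (b ∷ []) negative with b <? 0ℤ
... | yes _ = refl
... | no b≮0 = ⊥-elim (b≮0 (negative 0 z<s (ℕ.<-irrefl refl ∘ proj₁)))
negCount-pinnacles-∷ a (b ∷ c ∷ t) negative =
  subst (λ P → negCount (b ∷ c ∷ t) + length P ≡ length (b ∷ c ∷ t) + negCount P)
        (sym (pinnacles-∷∷∷ a b c t))
    (negCount-if-∷ ((a <? b) ×-dec (c <? b)) (λ ¬pin → negative 0 z<s (¬pin ∘ proj₂))
      (negCount-pinnacles-∷ b (c ∷ t) λ i i<n ¬pin →
        negative (suc i) (s<s i<n) (¬pin ∘ Equivalence.to (pinnacle-∷ a (b ∷ c ∷ t) i))))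

negCount-pinnacles : ∀ w → NonPinnaclesNegative w →
                     negCount w + length (pinnacles w) ≡ length w + negCount (pinnacles w)
negCount-pinnacles [] _ = refl
negCount-pinnacles (a ∷ t) negative with a <? 0ℤ
... | yes _ = cong suc (negCount-pinnacles-∷ a t λ i i<n → negative (suc i) (s<s i<n))
... | no a≮0 = ⊥-elim (a≮0 (negative 0 z<s λ ()))

pinnacles-parity : ∀ w → length w % 2 ≡ 1 → negCount w % 2 ≡ 1 → NonPinnaclesNegative w →
                   length (pinnacles w) % 2 ≡ negCount (pinnacles w) % 2
pinnacles-parity w oddLength oddNeg negative =
  odd-+-cancel {negCount w} {length (pinnacles w)} {length w} {negCount (pinnacles w)}
    oddNeg oddLength (negCount-pinnacles w negative)

get-∈ : ∀ w i → i ℕ.< length w → get w i ∈ w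
get-∈ (x ∷ w) zero _ = here refl
get-∈ (x ∷ w) (suc i) i<n = there (get-∈ w i (s<s⁻¹ i<n))

signed-length : ∀ {n w} → IsSignedPerm n w → length w ≡ n
signed-length {n} {w} signed = begin
  length w                  ≡⟨ List.length-map ∣_∣ w ⟨
  length (map ∣_∣ w)        ≡⟨ ↭-length signed ⟩
  length (map suc (upTo n)) ≡⟨ List.length-map suc (upTo n) ⟩
  length (upTo n)           ≡⟨ List.length-upTo n ⟩
  n                         ∎

signed-abs-unique : ∀ {n w} → IsSignedPerm n w → Unique (map ∣_∣ w)
signed-abs-unique {n} signed =
  Unique-resp-↭ (setoid ℕ) (↭⇒↭ₛ (↭-sym signed)) (Unique.map⁺ ℕ.suc-injective (Unique.upTo⁺ n))

signed-nonzero : ∀ {n w} → IsSignedPerm n w → ∀ i → i ℕ.< length w → get w i ≢ 0ℤ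
signed-nonzero {w = w} signed i i<n is-zero
  with ∈-map⁻ suc (∈-resp-↭ signed (∈-map⁺ ∣_∣ (get-∈ w i i<n)))
... | _ , _ , e = ℕ.0≢1+n (trans (cong ∣_∣ (sym is-zero)) e)

abs-unique⇒adjacent-distinct : ∀ w → Unique (map ∣_∣ w) →
                               ∀ i → suc i ℕ.< length w → ∣ get w i ∣ ≢ ∣ get w (suc i) ∣
abs-unique⇒adjacent-distinct (a ∷ b ∷ w) ((a≢b ∷ _) ∷ _) zero _ = a≢b
abs-unique⇒adjacent-distinct (a ∷ []) _ zero (s<s ())
abs-unique⇒adjacent-distinct (a ∷ w) (_ ∷ u) (suc i) i<n = abs-unique⇒adjacent-distinct w u i (s<s⁻¹ i<n)

safeFlip⇒APSD : ∀ {n S w j} → IsSignedPerm n w → IsPinnacleSetOf S w → negCount w % 2 ≡ 1 →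
                SafeFlip w j → APSD n S
safeFlip⇒APSD {n} {S} {w} {j} signed pinnacleSet odd safe =
  flipAt j w , (signed′ , even) ,
  λ x → subst (λ P → (x ∈ S) ⇔ (x ∈ P)) (pinnacles-flipAt safe) (pinnacleSet x)
  where
  open SafeFlip safe
  signed′ : IsSignedPerm n (flipAt j w)
  signed′ = subst (_↭ map suc (upTo n)) (sym (map-∣∣-flipAt j w)) signed
  even : negCount (flipAt j w) % 2 ≡ 0
  even = trans (negCount-flipAt j w bounded (signed-nonzero signed j bounded))
               (%2-suc-cong (negCount w) 1 odd)

odd-negCount : ∀ {n S w} → IsSignedPerm n w → IsPinnacleSetOf S w → ¬ APSD n S → negCount w % 2 ≡ 1
odd-negCount {w = w} signed pinnacleSet notD with %2-dichotomy (negCount w)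
... | inj₁ even = ⊥-elim (notD (w , (signed , even) , pinnacleSet))
... | inj₂ odd = odd

pinnacleSet-↭ : ∀ {S w} → Unique S → Unique w → IsPinnacleSetOf S w → S ↭ pinnacles w
pinnacleSet-↭ {w = w} uniqueS uniqueW pinnacleSet =
  ∼bag⇒↭ (unique∧set⇒bag uniqueS (pinnacles-unique w uniqueW) λ {x} → pinnacleSet x)

corollary4p7 : (k : ℕ) (S : List ℤ) → Unique S →
    APSB (2 * k + 1) S → ¬ APSD (2 * k + 1) S →
    length (filter (_<? 0ℤ) S) % 2 ≡ length S % 2
corollary4p7 k S uniqueS (w , signed , pinnacleSet) notD = begin
  negCount S % 2                ≡⟨ cong (_% 2) (↭-length (filter-↭ (_<? 0ℤ) S↭P)) ⟩
  negCount (pinnacles w) % 2    ≡⟨ pinnacles-parity w oddLength oddNeg nonPinnaclesNegative ⟨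
  length (pinnacles w) % 2      ≡⟨ cong (_% 2) (↭-length S↭P) ⟨
  length S % 2                  ∎
  where
  absUnique : Unique (map ∣_∣ w)
  absUnique = signed-abs-unique signed

  S↭P : S ↭ pinnacles w
  S↭P = pinnacleSet-↭ uniqueS (Unique.map⁻ absUnique) pinnacleSet

  oddNeg : negCount w % 2 ≡ 1
  oddNeg = odd-negCount signed pinnacleSet notD

  oddLength : length w % 2 ≡ 1
  oddLength = subst (λ m → m % 2 ≡ 1) (sym (signed-length signed)) (2k+1%2≡1 k)

  nonPinnaclesNegative : NonPinnaclesNegative w
  nonPinnaclesNegative =
    SafeFlipSearch.nonPinnaclesNegative w (signed-nonzero signed) (abs-unique⇒adjacent-distinct w absUnique)
      λ j → notD ∘ safeFlip⇒APSD signed pinnacleSet oddNeg
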